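{- Let $(a_n)_{n\geq 0}$ be a sequence of complex numbers and let $(b_n)_{n\geq0}$ be its Stirling transform, $b_n=\sum_{k=0}^{n}\genfrac{\{}{\}}{0pt}{}{n}{k}a_k$. Then for every $n\geq 0$, $$\det\left(b_{i+j}\right)_{0\leq i,j\leq n}=\det\left(\sum_{k=0}^{i}\genfrac{\{}{\}}{0pt}{}{i+j}{k+j}_{j}a_{k+j}\right)_{0\leq i,j\leq n}.$$
   Context: $\genfrac{\{}{\}}{0pt}{}{n}{k}$ denotes the Stirling numbers of the second kind. For an integer $r\geq 0$, the $r$-Stirling numbers of the second kind $\genfrac{\{}{\}}{0pt}{}{n}{k}_{r}$ are defined by: $\genfrac{\{}{\}}{0pt}{}{n}{k}_{r}=0$ for $n<r$; $\genfrac{\{}{\}}{0pt}{}{n}{k}_{r}=\delta_{k,r}$ for $n=r$; and $\genfrac{\{}{\}}{0pt}{}{n}{k}_{r}=k\genfrac{\{}{\}}{0pt}{}{n-1}{k}_{r}+\genfrac{\{}{\}}{0pt}{}{n-1}{k-1}_{r}$ for $n>r$; for $r=0$ these coincide with $\genfrac{\{}{\}}{0pt}{}{n}{k}$. -}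

module Defs where

open import Level using (Level)
open import Data.Nat using (ℕ; zero; suc; _≡ᵇ_; _<ᵇ_)
import Data.Nat as N
open import Data.Bool using (Bool; true; false; if_then_else_; _∧_)
open import Data.Fin using (Fin; zero; suc; toℕ; punchIn)
open import Algebra.Bundles using (CommutativeRing)

-- r-Stirling numbers of the second kind  {n k}_r  (rStirling r n k),
-- defined exactly by the three-case recursion of the paper:
--   0 if n < r ;  δ_{k,r} if n = r ;  k {n-1,k}_r + {n-1,k-1}_r if n > r
-- (with {n-1,-1}_r = 0).
δ : ℕ → ℕ → ℕ
δ k r = if k ≡ᵇ r then 1 else 0

rStirling : ℕ → ℕ → ℕ → ℕ
rStirling r zero k = if r ≡ᵇ 0 then δ k r else 0
rStirling r (suc m) k =
  if suc m <ᵇ r then 0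
  else if suc m ≡ᵇ r then δ k r
  else step k
  where
  step : ℕ → ℕ
  step zero = 0 N.* rStirling r m zero
  step (suc k') = suc k' N.* rStirling r m (suc k') N.+ rStirling r m k'

stirling : ℕ → ℕ → ℕ
stirling n k = rStirling 0 n k

module _ {c ℓ : Level} (R : CommutativeRing c ℓ) where
  open CommutativeRing R using (Carrier; _+_; _*_; -_; 0#; 1#)

  natMul : ℕ → Carrier → Carrier
  natMul zero x = 0#
  natMul (suc n) x = x + natMul n x

  sumTo : ℕ → (ℕ → Carrier) → Carrier
  sumTo zero f = f zero
  sumTo (suc n) f = sumTo n f + f (suc n)

  sumFin : (n : ℕ) → (Fin n → Carrier) → Carrier
  sumFin zero f = 0#
  sumFin (suc n) f = f zero + sumFin n (λ j → f (suc j))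

  altSign : ℕ → Carrier
  altSign zero = 1#
  altSign (suc k) = - altSign k

  det : (n : ℕ) → (Fin n → Fin n → Carrier) → Carrier
  det zero M = 1#
  det (suc n) M =
    sumFin (suc n) (λ j → altSign (toℕ j) * (M zero j * det n (λ i k → M (suc i) (punchIn j k))))

  stirlingTransform : (ℕ → Carrier) → ℕ → Carrier
  stirlingTransform a n = sumTo n (λ k → natMul (stirling n k) (a k))

-- Let T r n = Σₖ {n k}ᵣ aₖ, so that b n = T 0 n.  For m ≥ r the r-Stirling numbers satisfy
-- {m+1, k}ᵣ = {m+1, k}ᵣ₊₁ + r {m, k}ᵣ, hence T r (m+1) = T (r+1) (m+1) + r · T r m.
-- Starting from the Hankel matrix (T 0 (i+j)), step s subtracts s times column j−1 from
-- column j for every j > s (right to left, so the determinant is unchanged); this lifts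
-- column j from T s to T (s+1).  After n steps column j is (T j (i+j))ᵢ, and T j (i+j) is
-- the right-hand entry because {i+j, k}ⱼ = 0 for k < j.
module Submission where

open import Defs
open import Level using (Level)
open import Algebra.Bundles using (CommutativeRing)
open import Function using (_∘_)
open import Data.Bool using (true; false)
open import Data.Empty using (⊥-elim)
open import Data.Fin using (Fin; toℕ; punchIn) renaming (zero to fzero; suc to fsuc)
open import Data.Nat
  using (ℕ; zero; suc; _+_; _*_; _⊓_; _≤_; _<_; _≤′_; ≤′-refl; ≤′-step; z≤n; s≤s;
         _≡ᵇ_; _<ᵇ_; _≟_; _≤?_; _<?_)
import Data.Nat.Properties as ℕ
open import Data.Nat.Properties
  using (≤-refl; ≤-trans; <-trans; ≤-pred; <⇒≤; n<1+n; m≤n⇒m≤1+n; m<n⇒m<1+n; m≤n+m;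
         <⇒≢; >⇒≢; <⇒≱; ≰⇒>; ≮⇒≥; ≤∧≢⇒<; <-cmp; ≤′⇒≤; ≤⇒≤′; suc-injective; +-suc;
         m≤n⇒m⊓n≡m; m≥n⇒m⊓n≡n; ⊓-zeroʳ)
open import Data.Nat.Tactic.RingSolver using (solve-∀)
open import Relation.Nullary using (Dec; yes; no)
open import Relation.Binary using (tri<; tri≈; tri>)
import Relation.Binary.PropositionalEquality as ≡
open ≡ using (_≡_; _≢_; cong; cong₂)

<ᵇ-true : ∀ {m n} → m < n → (m <ᵇ n) ≡ true
<ᵇ-true {zero} (s≤s _) = ≡.refl
<ᵇ-true {suc m} (s≤s m<n) = <ᵇ-true m<n

<ᵇ-false : ∀ {m n} → n ≤ m → (m <ᵇ n) ≡ false
<ᵇ-false z≤n = ≡.refl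
<ᵇ-false (s≤s n≤m) = <ᵇ-false n≤m

≡ᵇ-refl : ∀ n → (n ≡ᵇ n) ≡ true
≡ᵇ-refl zero = ≡.refl
≡ᵇ-refl (suc n) = ≡ᵇ-refl n

≡ᵇ-false : ∀ {m n} → m ≢ n → (m ≡ᵇ n) ≡ false
≡ᵇ-false {zero} {zero} m≢n = ⊥-elim (m≢n ≡.refl)
≡ᵇ-false {zero} {suc n} _ = ≡.refl
≡ᵇ-false {suc m} {zero} _ = ≡.refl
≡ᵇ-false {suc m} {suc n} m≢n = ≡ᵇ-false (λ m≡n → m≢n (cong suc m≡n))

δ-≢ : ∀ {k r} → k ≢ r → δ k r ≡ 0
δ-≢ k≢r rewrite ≡ᵇ-false k≢r = ≡.refl

*-δ : ∀ k r → k * δ k r ≡ r * δ k r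
*-δ k r with k ≟ r
... | yes ≡.refl = ≡.refl
... | no k≢r rewrite δ-≢ k≢r = ≡.trans (ℕ.*-zeroʳ k) (≡.sym (ℕ.*-zeroʳ r))

rStirling-n<r : ∀ {r n k} → n < r → rStirling r n k ≡ 0
rStirling-n<r {suc r} {zero} _ = ≡.refl
rStirling-n<r {n = suc n} n<r rewrite <ᵇ-true n<r = ≡.refl

rStirling-diag : ∀ r k → rStirling r r k ≡ δ k r
rStirling-diag zero k = ≡.refl
rStirling-diag (suc r) k rewrite <ᵇ-false (≤-refl {suc r}) | ≡ᵇ-refl r = ≡.refl

rStirling-suc-zero : ∀ {r m} → r ≤ m → rStirling r (suc m) zero ≡ 0
rStirling-suc-zero r≤m rewrite <ᵇ-false (m≤n⇒m≤1+n r≤m) | ≡ᵇ-false (>⇒≢ (s≤s r≤m)) = ≡.refl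

rStirling-suc-suc : ∀ {r m k} → r ≤ m →
  rStirling r (suc m) (suc k) ≡ suc k * rStirling r m (suc k) + rStirling r m k
rStirling-suc-suc r≤m rewrite <ᵇ-false (m≤n⇒m≤1+n r≤m) | ≡ᵇ-false (>⇒≢ (s≤s r≤m)) = ≡.refl

combination-zero : ∀ k {x y} → x ≡ 0 → y ≡ 0 → k * x + y ≡ 0
combination-zero k ≡.refl ≡.refl = ≡.trans (ℕ.+-identityʳ (k * 0)) (ℕ.*-zeroʳ k)

rStirling-k<r : ∀ {r k} n → k < r → rStirling r n k ≡ 0
rStirling-k<r {r} n k<r with <-cmp n r
... | tri< n<r _ _ = rStirling-n<r n<r
... | tri≈ _ ≡.refl _ = ≡.trans (rStirling-diag n _) (δ-≢ (<⇒≢ k<r))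
rStirling-k<r {k = zero} (suc m) _ | tri> _ _ (s≤s r≤m) = rStirling-suc-zero r≤m
rStirling-k<r {k = suc k} (suc m) k<r | tri> _ _ (s≤s r≤m) =
  ≡.trans (rStirling-suc-suc r≤m)
    (combination-zero (suc k) (rStirling-k<r m k<r) (rStirling-k<r m (<-trans (n<1+n k) k<r)))

rStirling-n<k : ∀ {r k} n → n < k → rStirling r n k ≡ 0
rStirling-n<k {r} n n<k with <-cmp n r
... | tri< n<r _ _ = rStirling-n<r n<r
... | tri≈ _ ≡.refl _ = ≡.trans (rStirling-diag n _) (δ-≢ (>⇒≢ n<k))
rStirling-n<k {k = suc k} (suc m) (s≤s m<k) | tri> _ _ (s≤s r≤m) =
  ≡.trans (rStirling-suc-suc r≤m)
    (combination-zero (suc k) (rStirling-n<k m (<-trans m<k (n<1+n k))) (rStirling-n<k m m<k))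

module _ where
  open ≡.≡-Reasoning

  rStirling-lower : ∀ {r m} k → r ≤′ m →
    rStirling r (suc m) k ≡ rStirling (suc r) (suc m) k + r * rStirling r m k
  rStirling-lower {r} zero ≤′-refl = begin
    rStirling r (suc r) 0          ≡⟨ rStirling-suc-zero {r} {r} ≤-refl ⟩
    0 * δ 0 r                      ≡⟨ *-δ 0 r ⟩
    r * δ 0 r                      ≡⟨ cong (r *_) (rStirling-diag r 0) ⟨
    δ 0 (suc r) + r * rStirling r r 0  ≡⟨ cong (_+ r * rStirling r r 0) (rStirling-diag (suc r) 0) ⟨
    rStirling (suc r) (suc r) 0 + r * rStirling r r 0 ∎
  rStirling-lower {r} (suc k) ≤′-refl = begin
    rStirling r (suc r) (suc k)                       ≡⟨ rStirling-suc-suc {r} {r} ≤-refl ⟩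
    suc k * rStirling r r (suc k) + rStirling r r k   ≡⟨ cong₂ (λ x y → suc k * x + y) (rStirling-diag r (suc k)) (rStirling-diag r k) ⟩
    suc k * δ (suc k) r + δ k r                       ≡⟨ cong (_+ δ k r) (*-δ (suc k) r) ⟩
    r * δ (suc k) r + δ k r                           ≡⟨ ℕ.+-comm (r * δ (suc k) r) (δ k r) ⟩
    δ k r + r * δ (suc k) r                           ≡⟨ cong₂ (λ x y → x + r * y) (rStirling-diag (suc r) (suc k)) (rStirling-diag r (suc k)) ⟨
    rStirling (suc r) (suc r) (suc k) + r * rStirling r r (suc k) ∎
  rStirling-lower {r} {suc m} zero (≤′-step r≤′m) = begin
    rStirling r (suc (suc m)) 0 ≡⟨ rStirling-suc-zero (m≤n⇒m≤1+n r≤m) ⟩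
    0                           ≡⟨ ℕ.*-zeroʳ r ⟨
    r * 0                       ≡⟨ cong₂ (λ x y → x + r * y) (rStirling-suc-zero (s≤s r≤m)) (rStirling-suc-zero r≤m) ⟨
    rStirling (suc r) (suc (suc m)) 0 + r * rStirling r (suc m) 0 ∎
    where r≤m = ≤′⇒≤ r≤′m
  rStirling-lower {r} {suc m} (suc k) (≤′-step r≤′m) = begin
    rStirling r (suc (suc m)) (suc k)
      ≡⟨ rStirling-suc-suc (m≤n⇒m≤1+n r≤m) ⟩
    suc k * S r (suc m) (suc k) + S r (suc m) k
      ≡⟨ cong₂ (λ x y → suc k * x + y) (rStirling-lower (suc k) r≤′m) (rStirling-lower k r≤′m) ⟩
    suc k * (S (suc r) (suc m) (suc k) + r * S r m (suc k)) + (S (suc r) (suc m) k + r * S r m k)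
      ≡⟨ regroup r (suc k) (S (suc r) (suc m) (suc k)) (S r m (suc k)) (S (suc r) (suc m) k) (S r m k) ⟩
    (suc k * S (suc r) (suc m) (suc k) + S (suc r) (suc m) k) + r * (suc k * S r m (suc k) + S r m k)
      ≡⟨ cong₂ (λ x y → x + r * y) (rStirling-suc-suc (s≤s r≤m)) (rStirling-suc-suc r≤m) ⟨
    S (suc r) (suc (suc m)) (suc k) + r * S r (suc m) (suc k) ∎
    where
    S = rStirling
    r≤m = ≤′⇒≤ r≤′m
    regroup : ∀ r j x y u v → j * (x + r * y) + (u + r * v) ≡ (j * x + u) + r * (j * y + v)
    regroup = solve-∀

skip : ℕ → ℕ → ℕ
skip zero k = suc k
skip (suc j) zero = zero
skip (suc j) (suc k) = suc (skip j k)

-- Inverse of skip j on ℕ ∖ {j}; the value at j is junk.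
unskip : ℕ → ℕ → ℕ
unskip zero zero = zero
unskip zero (suc p) = p
unskip (suc j) zero = zero
unskip (suc j) (suc p) = suc (unskip j p)

toℕ-punchIn : ∀ {n} (j : Fin (suc n)) (k : Fin n) → toℕ (punchIn j k) ≡ skip (toℕ j) (toℕ k)
toℕ-punchIn fzero k = ≡.refl
toℕ-punchIn (fsuc j) fzero = ≡.refl
toℕ-punchIn (fsuc j) (fsuc k) = cong suc (toℕ-punchIn j k)

skip-≤ : ∀ j k → skip j k ≤ suc k
skip-≤ zero k = ≤-refl
skip-≤ (suc j) zero = z≤n
skip-≤ (suc j) (suc k) = s≤s (skip-≤ j k)

skip-≢ : ∀ j k → skip j k ≢ j
skip-≢ (suc j) (suc k) e = skip-≢ j k (suc-injective e)

skip-injective : ∀ j {k k′} → skip j k ≡ skip j k′ → k ≡ k′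
skip-injective zero e = suc-injective e
skip-injective (suc j) {zero} {zero} e = ≡.refl
skip-injective (suc j) {suc k} {suc k′} e = cong suc (skip-injective j (suc-injective e))

skip-< : ∀ {j k} → k < j → skip j k ≡ k
skip-< {suc j} {zero} _ = ≡.refl
skip-< {suc j} {suc k} (s≤s k<j) = cong suc (skip-< k<j)

skip-≥ : ∀ {j k} → j ≤ k → skip j k ≡ suc k
skip-≥ {zero} _ = ≡.refl
skip-≥ (s≤s j≤k) = cong suc (skip-≥ j≤k)

skip-unskip : ∀ j p → p ≢ j → skip j (unskip j p) ≡ p
skip-unskip zero zero p≢j = ⊥-elim (p≢j ≡.refl)
skip-unskip zero (suc p) _ = ≡.refl
skip-unskip (suc j) zero _ = ≡.refl
skip-unskip (suc j) (suc p) p≢j = cong suc (skip-unskip j p (λ e → p≢j (cong suc e)))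

unskip-< : ∀ {j p n} → p ≢ j → p < suc n → j < suc n → unskip j p < n
unskip-< {zero} {zero} p≢j _ _ = ⊥-elim (p≢j ≡.refl)
unskip-< {zero} {suc p} _ (s≤s p<n) _ = p<n
unskip-< {suc j} {zero} {suc n} _ _ _ = s≤s z≤n
unskip-< {suc j} {zero} {zero} _ _ (s≤s ())
unskip-< {suc j} {suc p} {suc n} p≢j (s≤s p<n) (s≤s j<n) =
  s≤s (unskip-< (λ e → p≢j (cong suc e)) p<n j<n)

module _ {c ℓ : Level} (R : CommutativeRing c ℓ) where
  open CommutativeRing R renaming (_+_ to _+ᴿ_; _*_ to _*ᴿ_)
  open import Algebra.Properties.Semiring.Mult semiring using (_×_; ×-congʳ; ×-homo-+; ×-assocˡ; ×-assoc-*)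
  open import Algebra.Solver.Ring.NaturalCoefficients.Default commutativeSemiring
    using (solve; _:=_; _:+_; _:*_)
  open import Relation.Binary.Reasoning.Setoid setoid

  natMul≡× : ∀ n x → natMul R n x ≡ n × x
  natMul≡× zero x = ≡.refl
  natMul≡× (suc n) x = cong (x +ᴿ_) (natMul≡× n x)

  natMul-+ : ∀ m n x → natMul R (m + n) x ≈ natMul R m x +ᴿ natMul R n x
  natMul-+ m n x rewrite natMul≡× (m + n) x | natMul≡× m x | natMul≡× n x = ×-homo-+ x m n

  natMul-* : ∀ m n x → natMul R (m * n) x ≈ natMul R m 1# *ᴿ natMul R n x
  natMul-* m n x rewrite natMul≡× (m * n) x | natMul≡× m 1# | natMul≡× n x = begin
    (m * n) × x           ≈⟨ ×-assocˡ x m n ⟨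
    m × (n × x)           ≈⟨ ×-congʳ m (*-identityˡ (n × x)) ⟨
    m × (1# *ᴿ n × x)     ≈⟨ ×-assoc-* m 1# (n × x) ⟨
    (m × 1#) *ᴿ (n × x)   ∎

  +-*-interchange : ∀ u v w x y → (u +ᴿ y *ᴿ v) +ᴿ (w +ᴿ y *ᴿ x) ≈ (u +ᴿ w) +ᴿ y *ᴿ (v +ᴿ x)
  +-*-interchange = solve 5 (λ u v w x y → (u :+ y :* v) :+ (w :+ y :* x) := (u :+ w) :+ y :* (v :+ x)) refl

  *-distribˡ-+-scaled : ∀ x u v y → x *ᴿ (u +ᴿ y *ᴿ v) ≈ x *ᴿ u +ᴿ y *ᴿ (x *ᴿ v)
  *-distribˡ-+-scaled = solve 4 (λ x u v y → x :* (u :+ y :* v) := x :* u :+ y :* (x :* v)) refl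

  sumTo-cong : ∀ n {f g} → (∀ k → f k ≈ g k) → sumTo R n f ≈ sumTo R n g
  sumTo-cong zero f≈g = f≈g 0
  sumTo-cong (suc n) f≈g = +-cong (sumTo-cong n f≈g) (f≈g (suc n))

  sumTo-linear : ∀ n f g y → sumTo R n (λ k → f k +ᴿ y *ᴿ g k) ≈ sumTo R n f +ᴿ y *ᴿ sumTo R n g
  sumTo-linear zero f g y = refl
  sumTo-linear (suc n) f g y =
    trans (+-congʳ (sumTo-linear n f g y)) (+-*-interchange _ _ _ _ y)

  sumTo-≈-last : ∀ j g → (∀ m → m < j → g m ≈ 0#) → sumTo R j g ≈ g j
  sumTo-≈-last zero g _ = refl
  sumTo-≈-last (suc j) g g<j≈0 = begin
    sumTo R j g +ᴿ g (suc j) ≈⟨ +-congʳ (sumTo-≈-last j g (λ m m<j → g<j≈0 m (m<n⇒m<1+n m<j))) ⟩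
    g j +ᴿ g (suc j)         ≈⟨ +-congʳ (g<j≈0 j (n<1+n j)) ⟩
    0# +ᴿ g (suc j)          ≈⟨ +-identityˡ _ ⟩
    g (suc j)                ∎

  sumTo-shift : ∀ i j g → (∀ m → m < j → g m ≈ 0#) → sumTo R (i + j) g ≈ sumTo R i (λ k → g (k + j))
  sumTo-shift zero j g g<j≈0 = sumTo-≈-last j g g<j≈0
  sumTo-shift (suc i) j g g<j≈0 = +-congʳ (sumTo-shift i j g g<j≈0)

  sumBelow : ℕ → (ℕ → Carrier) → Carrier
  sumBelow zero f = 0#
  sumBelow (suc n) f = f 0 +ᴿ sumBelow n (λ j → f (suc j))

  sumFin≈sumBelow : ∀ n {f : Fin n → Carrier} {g} → (∀ j → f j ≈ g (toℕ j)) → sumFin R n f ≈ sumBelow n g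
  sumFin≈sumBelow zero f≈g = refl
  sumFin≈sumBelow (suc n) f≈g = +-cong (f≈g fzero) (sumFin≈sumBelow n (λ j → f≈g (fsuc j)))

  sumBelow-cong : ∀ n {f g} → (∀ j → j < n → f j ≈ g j) → sumBelow n f ≈ sumBelow n g
  sumBelow-cong zero _ = refl
  sumBelow-cong (suc n) f≈g = +-cong (f≈g 0 (s≤s z≤n)) (sumBelow-cong n (λ j j<n → f≈g (suc j) (s≤s j<n)))

  sumBelow-zero : ∀ n {f} → (∀ j → j < n → f j ≈ 0#) → sumBelow n f ≈ 0#
  sumBelow-zero zero _ = refl
  sumBelow-zero (suc n) f≈0 =
    trans (+-cong (f≈0 0 (s≤s z≤n)) (sumBelow-zero n (λ j j<n → f≈0 (suc j) (s≤s j<n)))) (+-identityʳ 0#)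

  sumBelow-linear : ∀ n f g y → sumBelow n (λ j → f j +ᴿ y *ᴿ g j) ≈ sumBelow n f +ᴿ y *ᴿ sumBelow n g
  sumBelow-linear zero f g y = sym (trans (+-congˡ (zeroʳ y)) (+-identityʳ 0#))
  sumBelow-linear (suc n) f g y =
    trans (+-congˡ (sumBelow-linear n _ _ y)) (+-*-interchange _ _ _ _ y)

  sumBelow-pair : ∀ n p {f} → suc p < n → (∀ j → j < n → j ≢ p → j ≢ suc p → f j ≈ 0#) →
                  sumBelow n f ≈ f p +ᴿ f (suc p)
  sumBelow-pair (suc (suc n)) zero {f} _ others≈0 = begin
    f 0 +ᴿ (f 1 +ᴿ sumBelow n (λ j → f (suc (suc j))))
      ≈⟨ +-congˡ (+-congˡ (sumBelow-zero n (λ j j<n → others≈0 (suc (suc j)) (s≤s (s≤s j<n)) (λ ()) (λ ())))) ⟩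
    f 0 +ᴿ (f 1 +ᴿ 0#) ≈⟨ +-congˡ (+-identityʳ _) ⟩
    f 0 +ᴿ f 1         ∎
  sumBelow-pair (suc n) (suc p) {f} (s≤s p<n) others≈0 = begin
    f 0 +ᴿ sumBelow n (λ j → f (suc j))
      ≈⟨ +-cong (others≈0 0 (s≤s z≤n) (λ ()) (λ ()))
                (sumBelow-pair n p p<n (λ j j<n j≢p j≢sp →
                  others≈0 (suc j) (s≤s j<n) (j≢p ∘ suc-injective) (j≢sp ∘ suc-injective))) ⟩
    0# +ᴿ (f (suc p) +ᴿ f (suc (suc p))) ≈⟨ +-identityˡ _ ⟩
    f (suc p) +ᴿ f (suc (suc p))         ∎

  Matrix : Set c
  Matrix = ℕ → ℕ → Carrier

  minor : Matrix → ℕ → Matrix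
  minor M j i k = M (suc i) (skip j k)

  -- det of Defs, for ℕ-indexed matrices, so that neighbouring columns j and suc j can be named.
  detℕ : ℕ → Matrix → Carrier
  detℕ zero M = 1#
  detℕ (suc n) M = sumBelow (suc n) (λ j → altSign R j *ᴿ (M 0 j *ᴿ detℕ n (minor M j)))

  laplaceTerm : ℕ → Matrix → ℕ → Carrier
  laplaceTerm n M j = altSign R j *ᴿ (M 0 j *ᴿ detℕ n (minor M j))

  det≈detℕ : ∀ n {M : Fin n → Fin n → Carrier} {N : Matrix} →
             (∀ i j → M i j ≈ N (toℕ i) (toℕ j)) → det R n M ≈ detℕ n N
  det≈detℕ zero _ = refl
  det≈detℕ (suc n) {M} {N} M≈N = sumFin≈sumBelow (suc n) {g = laplaceTerm n N} λ j →
    *-congˡ (*-cong (M≈N fzero j) (det≈detℕ n {N = minor N (toℕ j)} λ i k →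
      trans (M≈N (fsuc i) (punchIn j k)) (reflexive (cong (N (suc (toℕ i))) (toℕ-punchIn j k)))))

  detℕ-cong : ∀ n {M N} → (∀ i j → i < n → j < n → M i j ≈ N i j) → detℕ n M ≈ detℕ n N
  detℕ-cong zero _ = refl
  detℕ-cong (suc n) {M} {N} M≈N = sumBelow-cong (suc n) {laplaceTerm n M} {laplaceTerm n N} λ j j<n →
    *-congˡ (*-cong (M≈N 0 j (s≤s z≤n) j<n) (detℕ-cong n {minor M j} {minor N j} λ i k i<n k<n →
      M≈N (suc i) (skip j k) (s≤s i<n) (s≤s (≤-trans (skip-≤ j k) k<n))))

  detℕ-linear : ∀ n p {M A B : Matrix} y → p < n →
    (∀ i k → k ≢ p → M i k ≈ A i k) → (∀ i k → k ≢ p → M i k ≈ B i k) →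
    (∀ i → M i p ≈ A i p +ᴿ y *ᴿ B i p) → detℕ n M ≈ detℕ n A +ᴿ y *ᴿ detℕ n B
  detℕ-linear (suc n) p {M} {A} {B} y p<n M≈A M≈B M≈A+yB =
    trans (sumBelow-cong (suc n) {laplaceTerm n M} term) (sumBelow-linear (suc n) (laplaceTerm n A) (laplaceTerm n B) y)
    where
    term : ∀ j → j < suc n → laplaceTerm n M j ≈ laplaceTerm n A j +ᴿ y *ᴿ laplaceTerm n B j
    term j j<n with j ≟ p
    ... | yes ≡.refl = begin
      altSign R j *ᴿ (M 0 j *ᴿ detℕ n (minor M j))
        ≈⟨ *-congˡ (*-cong (M≈A+yB 0) (detℕ-cong n {minor M j} {minor A j} λ i k _ _ → M≈A (suc i) (skip j k) (skip-≢ j k))) ⟩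
      altSign R j *ᴿ ((A 0 j +ᴿ y *ᴿ B 0 j) *ᴿ D)
        ≈⟨ *-congˡ (trans (*-comm _ D) (*-distribˡ-+-scaled D (A 0 j) (B 0 j) y)) ⟩
      altSign R j *ᴿ (D *ᴿ A 0 j +ᴿ y *ᴿ (D *ᴿ B 0 j))
        ≈⟨ *-distribˡ-+-scaled (altSign R j) _ _ y ⟩
      altSign R j *ᴿ (D *ᴿ A 0 j) +ᴿ y *ᴿ (altSign R j *ᴿ (D *ᴿ B 0 j))
        ≈⟨ +-cong (*-congˡ (*-comm D (A 0 j))) (*-congˡ (*-congˡ (trans (*-comm D (B 0 j)) (*-congˡ D≈minorB)))) ⟩
      laplaceTerm n A j +ᴿ y *ᴿ laplaceTerm n B j ∎
      where
      D = detℕ n (minor A j)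
      D≈minorB : D ≈ detℕ n (minor B j)
      D≈minorB = detℕ-cong n {minor A j} {minor B j} λ i k _ _ →
        trans (sym (M≈A (suc i) (skip j k) (skip-≢ j k))) (M≈B (suc i) (skip j k) (skip-≢ j k))
    ... | no j≢p = begin
      altSign R j *ᴿ (M 0 j *ᴿ detℕ n (minor M j))
        ≈⟨ *-congˡ (*-congˡ minor-linear) ⟩
      altSign R j *ᴿ (M 0 j *ᴿ (detℕ n (minor A j) +ᴿ y *ᴿ detℕ n (minor B j)))
        ≈⟨ *-congˡ (*-distribˡ-+-scaled (M 0 j) _ _ y) ⟩
      altSign R j *ᴿ (M 0 j *ᴿ detℕ n (minor A j) +ᴿ y *ᴿ (M 0 j *ᴿ detℕ n (minor B j)))
        ≈⟨ *-distribˡ-+-scaled (altSign R j) _ _ y ⟩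
      altSign R j *ᴿ (M 0 j *ᴿ detℕ n (minor A j)) +ᴿ y *ᴿ (altSign R j *ᴿ (M 0 j *ᴿ detℕ n (minor B j)))
        ≈⟨ +-cong (*-congˡ (*-congʳ (M≈A 0 j j≢p))) (*-congˡ (*-congˡ (*-congʳ (M≈B 0 j j≢p)))) ⟩
      laplaceTerm n A j +ᴿ y *ᴿ laplaceTerm n B j ∎
      where
      p′ = unskip j p
      skip≡p : skip j p′ ≡ p
      skip≡p = skip-unskip j p (j≢p ∘ ≡.sym)
      off-p′ : ∀ {k} → k ≢ p′ → skip j k ≢ p
      off-p′ k≢p′ e = k≢p′ (skip-injective j (≡.trans e (≡.sym skip≡p)))
      minor-linear : detℕ n (minor M j) ≈ detℕ n (minor A j) +ᴿ y *ᴿ detℕ n (minor B j)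
      minor-linear = detℕ-linear n p′ {minor M j} {minor A j} {minor B j} y (unskip-< (j≢p ∘ ≡.sym) p<n j<n)
        (λ i k k≢p′ → M≈A (suc i) (skip j k) (off-p′ k≢p′))
        (λ i k k≢p′ → M≈B (suc i) (skip j k) (off-p′ k≢p′))
        (λ i → ≡.subst (λ q → M (suc i) q ≈ A (suc i) q +ᴿ y *ᴿ B (suc i) q) (≡.sym skip≡p) (M≈A+yB (suc i)))

  detℕ-adjacent : ∀ n p {M} → suc p < n → (∀ i → M i p ≈ M i (suc p)) → detℕ n M ≈ 0#
  detℕ-adjacent (suc n) p {M} sp<n cols≈ = begin
    detℕ (suc n) M                               ≈⟨ sumBelow-pair (suc n) p sp<n other-term ⟩
    laplaceTerm n M p +ᴿ laplaceTerm n M (suc p) ≈⟨ +-congˡ (*-congˡ (*-cong (sym (cols≈ 0)) (sym same-minor))) ⟩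
    altSign R p *ᴿ X +ᴿ (- altSign R p) *ᴿ X     ≈⟨ distribʳ X _ _ ⟨
    (altSign R p +ᴿ - altSign R p) *ᴿ X          ≈⟨ *-congʳ (-‿inverseʳ _) ⟩
    0# *ᴿ X                                      ≈⟨ zeroˡ X ⟩
    0#                                           ∎
    where
    X = M 0 p *ᴿ detℕ n (minor M p)
    same-minor : detℕ n (minor M p) ≈ detℕ n (minor M (suc p))
    same-minor = detℕ-cong n {minor M p} {minor M (suc p)} λ i k _ _ → column i k
      where
      column : ∀ i k → M (suc i) (skip p k) ≈ M (suc i) (skip (suc p) k)
      column i k with <-cmp k p
      ... | tri< k<p _ _ = reflexive (cong (M (suc i)) (≡.trans (skip-< k<p) (≡.sym (skip-< (m<n⇒m<1+n k<p)))))
      ... | tri≈ _ ≡.refl _ = trans (reflexive (cong (M (suc i)) (skip-≥ ≤-refl)))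
                                (trans (sym (cols≈ (suc i))) (reflexive (cong (M (suc i)) (≡.sym (skip-< (n<1+n k))))))
      ... | tri> _ _ p<k = reflexive (cong (M (suc i)) (≡.trans (skip-≥ (<⇒≤ p<k)) (≡.sym (skip-≥ p<k))))
    minor-zero : ∀ {j} → detℕ n (minor M j) ≈ 0# → laplaceTerm n M j ≈ 0#
    minor-zero e = trans (*-congˡ (trans (*-congˡ e) (zeroʳ _))) (zeroʳ _)
    other-term : ∀ j → j < suc n → j ≢ p → j ≢ suc p → laplaceTerm n M j ≈ 0#
    other-term j j<n j≢p j≢sp with <-cmp j p
    ... | tri≈ _ j≡p _ = ⊥-elim (j≢p j≡p)
    ... | tri< (s≤s j≤q) _ _ = minor-zero (detℕ-adjacent n _ (≤-pred sp<n) λ i →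
          trans (reflexive (cong (M (suc i)) (skip-≥ j≤q)))
                (trans (cols≈ (suc i)) (reflexive (cong (M (suc i)) (≡.sym (skip-≥ (m≤n⇒m≤1+n j≤q)))))))
    ... | tri> _ _ p<j = minor-zero (detℕ-adjacent n p (≤-trans sp<j (≤-pred j<n)) λ i →
          trans (reflexive (cong (M (suc i)) (skip-< p<j)))
                (trans (cols≈ (suc i)) (reflexive (cong (M (suc i)) (≡.sym (skip-< sp<j))))))
      where
      sp<j : suc p < j
      sp<j = ≤∧≢⇒< p<j (j≢sp ∘ ≡.sym)

  detℕ-add-previous-column : ∀ n q {M N : Matrix} y → suc q < n →
    (∀ i k → k ≢ suc q → N i k ≈ M i k) → (∀ i → N i (suc q) ≈ M i (suc q) +ᴿ y *ᴿ M i q) →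
    detℕ n N ≈ detℕ n M
  detℕ-add-previous-column n q {M} {N} y sq<n N≈M N≈M+yM = begin
    detℕ n N                   ≈⟨ detℕ-linear n (suc q) {N} {M} {B} y sq<n N≈M N≈B N≈M+yB ⟩
    detℕ n M +ᴿ y *ᴿ detℕ n B  ≈⟨ +-congˡ (*-congˡ (detℕ-adjacent n q {B} sq<n B-adjacent)) ⟩
    detℕ n M +ᴿ y *ᴿ 0#        ≈⟨ +-congˡ (zeroʳ y) ⟩
    detℕ n M +ᴿ 0#             ≈⟨ +-identityʳ _ ⟩
    detℕ n M                   ∎
    where
    B : Matrix
    B i k with k ≟ suc q
    ... | yes _ = M i q
    ... | no _ = M i k
    B-adjacent : ∀ i → B i q ≈ B i (suc q)
    B-adjacent i with q ≟ suc q | suc q ≟ suc q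
    ... | no _ | yes _ = refl
    ... | yes q≡sq | _ = ⊥-elim (<⇒≢ (n<1+n q) q≡sq)
    ... | _ | no sq≢sq = ⊥-elim (sq≢sq ≡.refl)
    N≈B : ∀ i k → k ≢ suc q → N i k ≈ B i k
    N≈B i k k≢sq with k ≟ suc q
    ... | yes k≡sq = ⊥-elim (k≢sq k≡sq)
    ... | no _ = N≈M i k k≢sq
    N≈M+yB : ∀ i → N i (suc q) ≈ M i (suc q) +ᴿ y *ᴿ B i (suc q)
    N≈M+yB i with suc q ≟ suc q
    ... | yes _ = N≈M+yM i
    ... | no sq≢sq = ⊥-elim (sq≢sq ≡.refl)

  detℕ-shear : ∀ n {M N : Matrix} (c : ℕ → Carrier) → (∀ i → N i 0 ≈ M i 0) →
    (∀ i j → M i (suc j) ≈ N i (suc j) +ᴿ c j *ᴿ M i j) → detℕ n N ≈ detℕ n M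
  detℕ-shear n {M} {N} c N≈M M≈N+cM = begin
    detℕ n N     ≈⟨ detℕ-cong n {N} {S 0} (λ i j _ _ → N≈S₀ i j) ⟩
    detℕ n (S 0) ≈⟨ S-chain n ⟨
    detℕ n (S n) ≈⟨ detℕ-cong n {S n} {M} (λ i j _ j<n → reflexive (S-≤ (<⇒≤ j<n))) ⟩
    detℕ n M     ∎
    where
    S : ℕ → Matrix
    S t i j with j ≤? t
    ... | yes _ = M i j
    ... | no _ = N i j
    S-≤ : ∀ {t i j} → j ≤ t → S t i j ≡ M i j
    S-≤ {t} {i} {j} j≤t with j ≤? t
    ... | yes _ = ≡.refl
    ... | no j≰t = ⊥-elim (j≰t j≤t)
    S-> : ∀ {t i j} → t < j → S t i j ≡ N i j
    S-> {t} {i} {j} t<j with j ≤? t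
    ... | yes j≤t = ⊥-elim (<⇒≱ t<j j≤t)
    ... | no _ = ≡.refl
    N≈S₀ : ∀ i j → N i j ≈ S 0 i j
    N≈S₀ i zero = trans (N≈M i) (reflexive (≡.sym (S-≤ {0} {i} z≤n)))
    N≈S₀ i (suc j) = reflexive (≡.sym (S-> (s≤s z≤n)))
    S-step : ∀ t → detℕ n (S (suc t)) ≈ detℕ n (S t)
    S-step t with suc t <? n
    ... | yes st<n = detℕ-add-previous-column n t {S t} {S (suc t)} (c t) st<n unchanged shifted
      where
      unchanged : ∀ i k → k ≢ suc t → S (suc t) i k ≈ S t i k
      unchanged i k k≢st = reflexive (by-cases (k ≤? t))
        where
        by-cases : Dec (k ≤ t) → S (suc t) i k ≡ S t i k
        by-cases (yes k≤t) = ≡.trans (S-≤ (m≤n⇒m≤1+n k≤t)) (≡.sym (S-≤ k≤t))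
        by-cases (no k≰t) = ≡.trans (S-> (≤∧≢⇒< (≰⇒> k≰t) (k≢st ∘ ≡.sym))) (≡.sym (S-> (≰⇒> k≰t)))
      shifted : ∀ i → S (suc t) i (suc t) ≈ S t i (suc t) +ᴿ c t *ᴿ S t i t
      shifted i rewrite S-≤ {suc t} {i} ≤-refl | S-> {t} {i} (n<1+n t) | S-≤ {t} {i} ≤-refl = M≈N+cM i t
    ... | no st≮n = detℕ-cong n {S (suc t)} {S t} λ i k _ k<n →
      reflexive (≡.trans (S-≤ (≤-trans (<⇒≤ k<n) (≮⇒≥ st≮n))) (≡.sym (S-≤ (≤-pred (≤-trans k<n (≮⇒≥ st≮n))))))
    S-chain : ∀ t → detℕ n (S t) ≈ detℕ n (S 0)
    S-chain zero = refl
    S-chain (suc t) = trans (S-step t) (S-chain t)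

  module _ (a : ℕ → Carrier) where

    rStirlingTransform : ℕ → ℕ → Carrier
    rStirlingTransform r n = sumTo R n (λ k → natMul R (rStirling r n k) (a k))

    rStirlingTransform-lower : ∀ {r m} → r ≤ m →
      rStirlingTransform r (suc m) ≈ rStirlingTransform (suc r) (suc m) +ᴿ natMul R r 1# *ᴿ rStirlingTransform r m
    rStirlingTransform-lower {r} {m} r≤m = begin
      rStirlingTransform r (suc m)                                    ≈⟨ sumTo-cong (suc m) split ⟩
      sumTo R (suc m) (λ k → U k +ᴿ natMul R r 1# *ᴿ V k)             ≈⟨ sumTo-linear (suc m) U V _ ⟩
      rStirlingTransform (suc r) (suc m) +ᴿ natMul R r 1# *ᴿ (rStirlingTransform r m +ᴿ V (suc m))
        ≈⟨ +-congˡ (*-congˡ (trans (+-congˡ V-top) (+-identityʳ _))) ⟩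
      rStirlingTransform (suc r) (suc m) +ᴿ natMul R r 1# *ᴿ rStirlingTransform r m ∎
      where
      U V : ℕ → Carrier
      U k = natMul R (rStirling (suc r) (suc m) k) (a k)
      V k = natMul R (rStirling r m k) (a k)
      split : ∀ k → natMul R (rStirling r (suc m) k) (a k) ≈ U k +ᴿ natMul R r 1# *ᴿ V k
      split k = trans (reflexive (cong (λ x → natMul R x (a k)) (rStirling-lower k (≤⇒≤′ r≤m))))
                      (trans (natMul-+ (rStirling (suc r) (suc m) k) _ (a k)) (+-congˡ (natMul-* r (rStirling r m k) (a k))))
      V-top : V (suc m) ≈ 0#
      V-top = reflexive (cong (λ x → natMul R x (a (suc m))) (rStirling-n<k m (n<1+n m)))

    -- Column j uses the min(s, j)-Stirling transform: s = 0 is the Hankel matrix of the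
    -- Stirling transform, and s ≥ n is the right-hand matrix of the theorem.
    levelMatrix : ℕ → Matrix
    levelMatrix s i j = rStirlingTransform (s ⊓ j) (i + j)

    shearCoefficient : ℕ → ℕ → Carrier
    shearCoefficient s j with s ≤? j
    ... | yes _ = natMul R s 1#
    ... | no _ = 0#

    levelMatrix-shear : ∀ s i j →
      levelMatrix s i (suc j) ≈ levelMatrix (suc s) i (suc j) +ᴿ shearCoefficient s j *ᴿ levelMatrix s i j
    levelMatrix-shear s i j with s ≤? j
    ... | yes s≤j rewrite m≤n⇒m⊓n≡m (m≤n⇒m≤1+n s≤j) | m≤n⇒m⊓n≡m s≤j | +-suc i j =
      rStirlingTransform-lower (≤-trans s≤j (m≤n+m j i))
    ... | no s≰j rewrite m≥n⇒m⊓n≡n (≰⇒> s≰j) | m≥n⇒m⊓n≡n (<⇒≤ (≰⇒> s≰j)) =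
      sym (trans (+-congˡ (zeroˡ _)) (+-identityʳ _))

    det-levelMatrix : ∀ n s → detℕ n (levelMatrix s) ≈ detℕ n (levelMatrix 0)
    det-levelMatrix n zero = refl
    det-levelMatrix n (suc s) = trans
      (detℕ-shear n (shearCoefficient s) (λ i → reflexive (cong (λ r → rStirlingTransform r (i + 0)) (≡.sym (⊓-zeroʳ s))))
        (levelMatrix-shear s))
      (det-levelMatrix n s)

    rStirlingMatrix : Matrix
    rStirlingMatrix i j = sumTo R i (λ k → natMul R (rStirling j (i + j) (k + j)) (a (k + j)))

    levelMatrix-saturated : ∀ {s} i {j} → j ≤ s → levelMatrix s i j ≈ rStirlingMatrix i j
    levelMatrix-saturated {s} i {j} j≤s rewrite m≥n⇒m⊓n≡n j≤s =
      sumTo-shift i j _ λ m m<j → reflexive (cong (λ x → natMul R x (a m)) (rStirling-k<r (i + j) m<j))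

corollary2 : {c ℓ : Level} (R : CommutativeRing c ℓ) (a : ℕ → CommutativeRing.Carrier R) (n : ℕ) →
    CommutativeRing._≈_ R
      (det R (suc n) (λ i j → stirlingTransform R a (toℕ i + toℕ j)))
      (det R (suc n) (λ i j → sumTo R (toℕ i) (λ k → natMul R (rStirling (toℕ j) (toℕ i + toℕ j) (k + toℕ j)) (a (k + toℕ j)))))
corollary2 R a n = begin
  det R (suc n) (λ i j → stirlingTransform R a (toℕ i + toℕ j))
    ≈⟨ det≈detℕ R (suc n) {N = levelMatrix R a 0} (λ _ _ → refl) ⟩
  detℕ R (suc n) (levelMatrix R a 0)
    ≈⟨ det-levelMatrix R a (suc n) (suc n) ⟨
  detℕ R (suc n) (levelMatrix R a (suc n))
    ≈⟨ detℕ-cong R (suc n) (λ i _ _ j<n → levelMatrix-saturated R a i (<⇒≤ j<n)) ⟩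
  detℕ R (suc n) (rStirlingMatrix R a)
    ≈⟨ det≈detℕ R (suc n) {N = rStirlingMatrix R a} (λ _ _ → refl) ⟨
  det R (suc n) (λ i j → sumTo R (toℕ i) (λ k → natMul R (rStirling (toℕ j) (toℕ i + toℕ j) (k + toℕ j)) (a (k + toℕ j)))) ∎
  where
  open CommutativeRing R using (refl; setoid)
  open import Relation.Binary.Reasoning.Setoid setoid
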